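{- Let $M$ be a hypermodular matroid of rank at least $3$, and let $A$ be a flat of $M$ of corank at least $3$ (i.e. $r(M)-r(A)\ge3$). Then the contraction $M/A$ is a hypermodular matroid.
   Context: A pair of flats $\{A,B\}$ is modular if $r(A\cup B)+r(A\cap B)=r(A)+r(B)$. A matroid of rank $k\ge3$ is hypermodular if every pair of two corank-$1$ flats (flats of rank $k-1$) is a modular pair. -}

module Defs where

open import Data.Nat using (ℕ; _+_; _∸_; _≤_; _<_)
open import Data.Fin using (Fin)
open import Data.Fin.Subset using (Subset; _∪_; _∩_; _─_; _⊆_; _∈_; _∉_; ⁅_⁆; ∣_∣)
open import Data.Product using (_×_)
open import Relation.Binary.PropositionalEquality using (_≡_)

-- A "rank structure" on a ground set E ⊆ Fin n: the ground set together
-- with a rank function (only its values on subsets of E matter).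
record RankData (n : ℕ) : Set where
  constructor mkRankData
  field
    E : Subset n
    r : Subset n → ℕ

open RankData public

record IsMatroid {n : ℕ} (M : RankData n) : Set where
  field
    r-bound  : ∀ X → X ⊆ E M → r M X ≤ ∣ X ∣
    r-mono   : ∀ X Y → X ⊆ Y → Y ⊆ E M → r M X ≤ r M Y
    r-submod : ∀ X Y → X ⊆ E M → Y ⊆ E M →
               r M (X ∪ Y) + r M (X ∩ Y) ≤ r M X + r M Y

rk : {n : ℕ} → RankData n → ℕ
rk M = r M (E M)

IsFlat : {n : ℕ} → RankData n → Subset n → Set
IsFlat M F = F ⊆ E M × (∀ e → e ∈ E M → e ∉ F → r M F < r M (F ∪ ⁅ e ⁆))

ModularPair : {n : ℕ} → RankData n → Subset n → Subset n → Set
ModularPair M A B = r M (A ∪ B) + r M (A ∩ B) ≡ r M A + r M B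

Hypermodular : {n : ℕ} → RankData n → Set
Hypermodular M =
  3 ≤ rk M ×
  (∀ F G → IsFlat M F → IsFlat M G →
     r M F + 1 ≡ rk M → r M G + 1 ≡ rk M → ModularPair M F G)

contract : {n : ℕ} → RankData n → Subset n → RankData n
contract M A = mkRankData (E M ─ A) (λ X → r M (X ∪ A) ∸ r M A)

{-# OPTIONS --safe #-}
-- Since (F ∪ A) ∪ (G ∪ A) = (F ∪ G) ∪ A
-- and (F ∪ A) ∩ (G ∪ A) = (F ∩ G) ∪ A, the submodular inequality and the modular-pair
-- equation for F, G in M/A are those for F ∪ A, G ∪ A in M, shifted by 2 r(A). A flat F of
-- M/A of corank 1 lifts to the flat F ∪ A of M, again of corank 1, so hypermodularity of M
-- transfers; the corank hypothesis on A is exactly rk(M/A) ≥ 3.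
module Submission where

open import Defs
open import Data.Nat using (ℕ; _∸_; _≤_; _<_; _+_)
open import Data.Nat.Properties
open import Data.Fin.Subset using (Subset; _∪_; _∩_; _─_; _⊆_; ⁅_⁆; ∣_∣)
open import Data.Fin.Subset.Properties
open import Data.Product using (_×_; _,_; proj₁)
open import Data.Sum using ([_,_]′; inj₁; inj₂)
open import Function using (id; _∘_)
open import Relation.Nullary using (yes; no)
open import Relation.Binary.PropositionalEquality
import Algebra.Bundles as Bundles
import Algebra.Properties.CommutativeSemigroup as CommSemigroupProperties

private
  variable
    n : ℕ
    p q s : Subset n

∪-lub : p ⊆ s → q ⊆ s → p ∪ q ⊆ s
∪-lub {p = p} {q = q} p⊆s q⊆s = [ p⊆s , q⊆s ]′ ∘ x∈p∪q⁻ p q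

∪-monoˡ-⊆ : p ⊆ q → p ∪ s ⊆ q ∪ s
∪-monoˡ-⊆ {q = q} {s = s} p⊆q = ∪-lub (p⊆p∪q s ∘ p⊆q) (q⊆p∪q q s)

p─q∪q≡p : q ⊆ p → (p ─ q) ∪ q ≡ p
p─q∪q≡p {q = q} {p = p} q⊆p = ⊆-antisym (∪-lub (p─q⊆p p q) q⊆p) p⊆[p─q]∪q
  where
  p⊆[p─q]∪q : p ⊆ (p ─ q) ∪ q
  p⊆[p─q]∪q {x} x∈p with x ∈? q
  ... | yes x∈q = x∈p∪q⁺ (inj₂ x∈q)
  ... | no  x∉q = x∈p∪q⁺ (inj₁ (x∈p∧x∉q⇒x∈p─q x∈p x∉q))

m∸o<n∸o⇒m<n : ∀ {m n} o → m ∸ o < n ∸ o → m < n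
m∸o<n∸o⇒m<n o lt = ≰⇒> (λ n≤m → <⇒≱ lt (∸-monoˡ-≤ o n≤m))

[m∸o]+[n∸o]+[o+o]≡m+n : ∀ {m n o} → o ≤ m → o ≤ n → (m ∸ o) + (n ∸ o) + (o + o) ≡ m + n
[m∸o]+[n∸o]+[o+o]≡m+n {m} {n} {o} o≤m o≤n = begin
  (m ∸ o) + (n ∸ o) + (o + o)    ≡⟨ interchange (m ∸ o) (n ∸ o) o o ⟩
  ((m ∸ o) + o) + ((n ∸ o) + o)  ≡⟨ cong₂ _+_ (m∸n+n≡m o≤m) (m∸n+n≡m o≤n) ⟩
  m + n                          ∎
  where
  open ≡-Reasoning
  open CommSemigroupProperties +-commutativeSemigroup using (interchange)

module Contraction (M : RankData n) (isM : IsMatroid M) {A : Subset n} (A⊆E : A ⊆ E M) where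

  open IsMatroid isM
  open CommSemigroupProperties (Bundles.CommutativeMonoid.commutativeSemigroup (∪-commutativeMonoid n))
    using (interchange; xy∙z≈xz∙y)

  M/A : RankData n
  M/A = contract M A

  X∪A⊆E : ∀ {X} → X ⊆ E M/A → X ∪ A ⊆ E M
  X∪A⊆E X⊆E∖A = ∪-lub (p─q⊆p (E M) A ∘ X⊆E∖A) A⊆E

  r[A]≤r[X∪A] : ∀ {X} → X ⊆ E M/A → r M A ≤ r M (X ∪ A)
  r[A]≤r[X∪A] {X} X⊆E∖A = r-mono A (X ∪ A) (q⊆p∪q X A) (X∪A⊆E X⊆E∖A)

  rk-contract : rk M/A ≡ rk M ∸ r M A
  rk-contract = cong (λ S → r M S ∸ r M A) (p─q∪q≡p A⊆E)

  rank-pairSum : ∀ {X Y} → X ⊆ E M/A → Y ⊆ E M/A →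
    r M/A X + r M/A Y + (r M A + r M A) ≡ r M (X ∪ A) + r M (Y ∪ A)
  rank-pairSum X⊆ Y⊆ = [m∸o]+[n∸o]+[o+o]≡m+n (r[A]≤r[X∪A] X⊆) (r[A]≤r[X∪A] Y⊆)

  rank-joinMeetSum : ∀ {X Y} → X ⊆ E M/A → Y ⊆ E M/A →
    r M/A (X ∪ Y) + r M/A (X ∩ Y) + (r M A + r M A)
      ≡ r M ((X ∪ A) ∪ (Y ∪ A)) + r M ((X ∪ A) ∩ (Y ∪ A))
  rank-joinMeetSum {X} {Y} X⊆ Y⊆ = begin
    r M/A (X ∪ Y) + r M/A (X ∩ Y) + (r M A + r M A)
      ≡⟨ rank-pairSum (∪-lub X⊆ Y⊆) (X⊆ ∘ proj₁ ∘ x∈p∩q⁻ X Y) ⟩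
    r M ((X ∪ Y) ∪ A) + r M ((X ∩ Y) ∪ A)
      ≡⟨ cong₂ (λ S T → r M S + r M T) join∪A meet∪A ⟩
    r M ((X ∪ A) ∪ (Y ∪ A)) + r M ((X ∪ A) ∩ (Y ∪ A))  ∎
    where
    open ≡-Reasoning
    join∪A : (X ∪ Y) ∪ A ≡ (X ∪ A) ∪ (Y ∪ A)
    join∪A = begin
      (X ∪ Y) ∪ A        ≡⟨ cong ((X ∪ Y) ∪_) (∪-idem A) ⟨
      (X ∪ Y) ∪ (A ∪ A)  ≡⟨ interchange X Y A A ⟩
      (X ∪ A) ∪ (Y ∪ A)  ∎
    meet∪A : (X ∩ Y) ∪ A ≡ (X ∪ A) ∩ (Y ∪ A)
    meet∪A = ∪-distribʳ-∩ A X Y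

  contract-isMatroid : IsMatroid M/A
  contract-isMatroid = record
    { r-bound  = λ X X⊆ → m≤n+o⇒m∸n≤o (r M (X ∪ A)) (r M A) (r[X∪A]≤r[A]+∣X∣ X⊆)
    ; r-mono   = λ X Y X⊆Y Y⊆ → ∸-monoˡ-≤ (r M A) (r-mono (X ∪ A) (Y ∪ A) (∪-monoˡ-⊆ X⊆Y) (X∪A⊆E Y⊆))
    ; r-submod = λ X Y X⊆ Y⊆ → +-cancelʳ-≤ (r M A + r M A) _ _
        (subst₂ _≤_ (sym (rank-joinMeetSum X⊆ Y⊆)) (sym (rank-pairSum X⊆ Y⊆))
          (r-submod (X ∪ A) (Y ∪ A) (X∪A⊆E X⊆) (X∪A⊆E Y⊆)))
    }
    where
    r[X∪A]≤r[A]+∣X∣ : ∀ {X} → X ⊆ E M/A → r M (X ∪ A) ≤ r M A + ∣ X ∣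
    r[X∪A]≤r[A]+∣X∣ {X} X⊆ = begin
      r M (X ∪ A)                  ≤⟨ m≤m+n _ _ ⟩
      r M (X ∪ A) + r M (X ∩ A)    ≤⟨ r-submod X A (p─q⊆p (E M) A ∘ X⊆) A⊆E ⟩
      r M X + r M A                ≤⟨ +-monoˡ-≤ (r M A) (r-bound X (p─q⊆p (E M) A ∘ X⊆)) ⟩
      ∣ X ∣ + r M A                ≡⟨ +-comm ∣ X ∣ (r M A) ⟩
      r M A + ∣ X ∣                ∎
      where open ≤-Reasoning

  flat-lift : ∀ {F} → IsFlat M/A F → IsFlat M (F ∪ A)
  flat-lift {F} (F⊆ , rank-jumps) = X∪A⊆E F⊆ , λ e e∈E e∉F∪A →
    m∸o<n∸o⇒m<n (r M A)
      (subst (λ S → r M/A F < r M S ∸ r M A) (xy∙z≈xz∙y F ⁅ e ⁆ A)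
        (rank-jumps e (x∈p∧x∉q⇒x∈p─q e∈E (e∉F∪A ∘ q⊆p∪q F A)) (e∉F∪A ∘ p⊆p∪q A)))

  corank1-lift : ∀ {F} → F ⊆ E M/A → r M/A F + 1 ≡ rk M/A → r M (F ∪ A) + 1 ≡ rk M
  corank1-lift {F} F⊆ corank1 = ∸-cancelʳ-≡ (≤-trans A≤F∪A (m≤m+n _ 1)) r[A]≤rk
    (trans (+-∸-comm 1 A≤F∪A) (trans corank1 rk-contract))
    where
    A≤F∪A : r M A ≤ r M (F ∪ A)
    A≤F∪A = r[A]≤r[X∪A] F⊆
    r[A]≤rk : r M A ≤ rk M
    r[A]≤rk = r-mono A (E M) A⊆E id

  modularPair-descend : ∀ {X Y} → X ⊆ E M/A → Y ⊆ E M/A →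
    ModularPair M (X ∪ A) (Y ∪ A) → ModularPair M/A X Y
  modularPair-descend X⊆ Y⊆ modular = +-cancelʳ-≡ (r M A + r M A) _ _
    (trans (rank-joinMeetSum X⊆ Y⊆) (trans modular (sym (rank-pairSum X⊆ Y⊆))))

  contract-hypermodular : Hypermodular M → 3 ≤ rk M ∸ r M A → Hypermodular M/A
  contract-hypermodular (_ , hyperplanes-modular) 3≤corank =
    subst (3 ≤_) (sym rk-contract) 3≤corank ,
    λ F G F-flat G-flat F-corank1 G-corank1 →
      modularPair-descend (proj₁ F-flat) (proj₁ G-flat)
        (hyperplanes-modular (F ∪ A) (G ∪ A) (flat-lift F-flat) (flat-lift G-flat)
          (corank1-lift (proj₁ F-flat) F-corank1) (corank1-lift (proj₁ G-flat) G-corank1))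

proposition3p1 : (n : ℕ) (M : RankData n) → IsMatroid M → Hypermodular M →
    (A : Subset n) → IsFlat M A → 3 ≤ rk M ∸ r M A →
    IsMatroid (contract M A) × Hypermodular (contract M A)
proposition3p1 n M isM hyp A (A⊆E , _) 3≤corank =
  contract-isMatroid , contract-hypermodular hyp 3≤corank
  where open Contraction M isM A⊆E
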